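{- Let $G$ be a connected simple graph of diameter at least $3$. Then for every integer $s\geqslant 1$ the $s$-jet graph $\mathcal{J}_s(G)$ is not co-chordal.
   Context: For a simple graph $G$ with vertex set $\{x_1,\dots,x_n\}$ and $s\in\mathbb{N}$, the $s$-jet graph $\mathcal{J}_s(G)$ is the simple graph with vertex set $\{x_{i,j}\mid i=1,\dots,n,\ j=0,\dots,s\}$ in which $\{x_{i,j},x_{k,l}\}$ is an edge if and only if $\{x_i,x_k\}$ is an edge of $G$ and $j+l\leqslant s$. A graph is chordal if it has no induced cycle of length four or more; a graph is co-chordal if its complement is chordal. -}

module Defs where

open import Data.Nat using (ℕ; zero; suc; _+_; _≤_)
open import Data.Fin using (Fin; toℕ)
open import Data.Product using (Σ; ∃; _×_; _,_)
open import Data.Sum using (_⊎_)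
open import Relation.Nullary using (¬_)
open import Relation.Binary.PropositionalEquality using (_≡_; _≢_)
open import Function.Definitions using (Injective)
open import Function.Bundles using (_⇔_)

Graph : Set → Set₁
Graph V = V → V → Set

record IsSimple {V : Set} (E : Graph V) : Set where
  field
    irrefl : ∀ u → ¬ E u u
    sym    : ∀ u v → E u v → E v u

data Walk {V : Set} (E : Graph V) : V → V → ℕ → Set where
  nil  : ∀ {u} → Walk E u u 0
  cons : ∀ {u w v k} → E u w → Walk E w v k → Walk E u v (suc k)

Connected : {V : Set} → Graph V → Set
Connected {V} E = ∀ (u v : V) → ∃ λ k → Walk E u v k

DistAtLeast : {V : Set} → Graph V → V → V → ℕ → Set
DistAtLeast E u v d = ∀ k → Walk E u v k → d ≤ k

DiameterAtLeast : {V : Set} → Graph V → ℕ → Set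
DiameterAtLeast {V} E d = Σ V λ u → Σ V λ v → DistAtLeast E u v d

CycSucc : {k : ℕ} → Fin k → Fin k → Set
CycSucc {k} i j = (suc (toℕ i) ≡ toℕ j) ⊎ ((suc (toℕ i) ≡ k) × (toℕ j ≡ 0))

CycAdj : {k : ℕ} → Fin k → Fin k → Set
CycAdj i j = CycSucc i j ⊎ CycSucc j i

InducedCycle : {V : Set} → Graph V → ℕ → Set
InducedCycle {V} E k =
  Σ (Fin k → V) λ c → Injective _≡_ _≡_ c × (∀ i j → E (c i) (c j) ⇔ CycAdj i j)

Chordal : {V : Set} → Graph V → Set
Chordal E = ∀ k → 4 ≤ k → ¬ InducedCycle E k

Complement : {V : Set} → Graph V → Graph V
Complement E u v = (u ≢ v) × ¬ E u v

CoChordal : {V : Set} → Graph V → Set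
CoChordal E = Chordal (Complement E)

-- s-jet graph: vertices x_{i,j}, j = 0..s; x_{i,j} ~ x_{k,l} iff x_i ~ x_k and j + l ≤ s.
Jet : {n : ℕ} → (s : ℕ) → Graph (Fin n) → Graph (Fin n × Fin (suc s))
Jet s E (i , j) (k , l) = E i k × (toℕ j + toℕ l ≤ s)

{-# OPTIONS --safe #-}
-- A connected graph of diameter at least 3 contains an induced path a – b – c – d:
-- otherwise the ball of radius 2 around an endpoint of a diametral pair would be
-- closed under adjacency, hence contain everything (constructively this yields
-- only the double negation of such a path, which suffices here).  In the complement of 𝒥ₛ(G)
-- the vertices (a,0), (d,0), (b,s), (c,s) then span an induced 4-cycle: (b,s) and
-- (c,s) are non-adjacent in 𝒥ₛ(G) because s + s > s, while the chords
-- (a,0)(b,s) and (d,0)(c,s) are edges of 𝒥ₛ(G) because 0 + s ≤ s.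
module Submission where

open import Defs
open import Data.Nat using (ℕ; suc; _≤_; z≤n; s≤s; s≤s⁻¹)
open import Data.Nat.Properties using (+-comm; ≤-refl; m+n≤o⇒n≤o; <-irrefl)
open import Data.Fin using (Fin; toℕ; fromℕ) renaming (zero to fzero; suc to fsuc)
open import Data.Fin.Properties using (toℕ-fromℕ; toℕ-injective; toℕ<n)
open import Data.Product using (∃; _×_; _,_; proj₁; proj₂)
open import Data.Sum using (_⊎_; inj₁; inj₂)
open import Data.Sum.Function.Propositional using (_⊎-⇔_)
open import Data.Empty using (⊥-elim)
open import Relation.Nullary using (¬_)
open import Relation.Binary.PropositionalEquality
  using (_≡_; _≢_; refl; sym; cong; subst)
open import Function.Bundles using (_⇔_; mk⇔)
open import Function.Construct.Composition using (_⇔-∘_)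
open import Function.Construct.Symmetry using (⇔-sym)

private
  variable
    V : Set

Symmetric : Graph V → Set
Symmetric E = ∀ u v → E u v → E v u

Irreflexive : Graph V → Set
Irreflexive E = ∀ u → ¬ E u u

complement-sym : ∀ {E : Graph V} → Symmetric E → Symmetric (Complement E)
complement-sym E-sym u v (u≢v , ¬uv) = (λ v≡u → u≢v (sym v≡u)) , (λ vu → ¬uv (E-sym v u vu))

complement-irrefl : ∀ {E : Graph V} → Irreflexive (Complement E)
complement-irrefl u (u≢u , _) = u≢u refl

pattern i0 = fzero
pattern i1 = fsuc fzero
pattern i2 = fsuc (fsuc fzero)
pattern i3 = fsuc (fsuc (fsuc fzero))

next : Fin 4 → Fin 4
next i0 = i1
next i1 = i2
next i2 = i3
next i3 = i0

cycSucc⇒next : ∀ i {j : Fin 4} → CycSucc i j → j ≡ next i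
cycSucc⇒next i0 (inj₁ e) = toℕ-injective (sym e)
cycSucc⇒next i1 (inj₁ e) = toℕ-injective (sym e)
cycSucc⇒next i2 (inj₁ e) = toℕ-injective (sym e)
cycSucc⇒next i3 {j} (inj₁ e) = ⊥-elim (<-irrefl (sym e) (toℕ<n j))
cycSucc⇒next i3 (inj₂ (_ , e)) = toℕ-injective e
cycSucc⇒next i0 (inj₂ (() , _))
cycSucc⇒next i1 (inj₂ (() , _))
cycSucc⇒next i2 (inj₂ (() , _))

cycSucc-next : ∀ i → CycSucc i (next i)
cycSucc-next i0 = inj₁ refl
cycSucc-next i1 = inj₁ refl
cycSucc-next i2 = inj₁ refl
cycSucc-next i3 = inj₂ (refl , refl)

cycSucc⇔next : ∀ {i j : Fin 4} → CycSucc i j ⇔ (j ≡ next i)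
cycSucc⇔next {i} = mk⇔ (cycSucc⇒next i) (λ { refl → cycSucc-next i })

cycAdj⇔consecutive : ∀ {i j : Fin 4} → CycAdj i j ⇔ (j ≡ next i ⊎ i ≡ next j)
cycAdj⇔consecutive = cycSucc⇔next ⊎-⇔ cycSucc⇔next

record ChordlessSquare (H : Graph V) : Set where
  field
    a b c d : V
    ab : H a b
    bc : H b c
    cd : H c d
    da : H d a
    ¬ac : ¬ H a c
    ¬bd : ¬ H b d
    a≢c : a ≢ c
    b≢d : b ≢ d

module _ {H : Graph V} (H-sym : Symmetric H) (H-irrefl : Irreflexive H)
         (square : ChordlessSquare H) where

  open ChordlessSquare square

  corner : Fin 4 → V
  corner i0 = a
  corner i1 = b
  corner i2 = c
  corner i3 = d

  adjacent⇒distinct : ∀ {u v} → H u v → u ≢ v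
  adjacent⇒distinct h refl = H-irrefl _ h

  corner-injective : ∀ {i j} → corner i ≡ corner j → i ≡ j
  corner-injective {i0} {i0} _ = refl
  corner-injective {i0} {i1} e = ⊥-elim (adjacent⇒distinct ab e)
  corner-injective {i0} {i2} e = ⊥-elim (a≢c e)
  corner-injective {i0} {i3} e = ⊥-elim (adjacent⇒distinct da (sym e))
  corner-injective {i1} {i0} e = ⊥-elim (adjacent⇒distinct ab (sym e))
  corner-injective {i1} {i1} _ = refl
  corner-injective {i1} {i2} e = ⊥-elim (adjacent⇒distinct bc e)
  corner-injective {i1} {i3} e = ⊥-elim (b≢d e)
  corner-injective {i2} {i0} e = ⊥-elim (a≢c (sym e))
  corner-injective {i2} {i1} e = ⊥-elim (adjacent⇒distinct bc (sym e))
  corner-injective {i2} {i2} _ = refl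
  corner-injective {i2} {i3} e = ⊥-elim (adjacent⇒distinct cd e)
  corner-injective {i3} {i0} e = ⊥-elim (adjacent⇒distinct da e)
  corner-injective {i3} {i1} e = ⊥-elim (b≢d (sym e))
  corner-injective {i3} {i2} e = ⊥-elim (adjacent⇒distinct cd (sym e))
  corner-injective {i3} {i3} _ = refl

  corner-next : ∀ i → H (corner i) (corner (next i))
  corner-next i0 = ab
  corner-next i1 = bc
  corner-next i2 = cd
  corner-next i3 = da

  adjacent⇔consecutive : ∀ i j → H (corner i) (corner j) ⇔ (j ≡ next i ⊎ i ≡ next j)
  adjacent⇔consecutive i j = mk⇔ (to i j) from
    where
    to : ∀ i j → H (corner i) (corner j) → j ≡ next i ⊎ i ≡ next j
    to i0 i0 h = ⊥-elim (H-irrefl _ h)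
    to i0 i1 _ = inj₁ refl
    to i0 i2 h = ⊥-elim (¬ac h)
    to i0 i3 _ = inj₂ refl
    to i1 i0 _ = inj₂ refl
    to i1 i1 h = ⊥-elim (H-irrefl _ h)
    to i1 i2 _ = inj₁ refl
    to i1 i3 h = ⊥-elim (¬bd h)
    to i2 i0 h = ⊥-elim (¬ac (H-sym _ _ h))
    to i2 i1 _ = inj₂ refl
    to i2 i2 h = ⊥-elim (H-irrefl _ h)
    to i2 i3 _ = inj₁ refl
    to i3 i0 _ = inj₁ refl
    to i3 i1 h = ⊥-elim (¬bd (H-sym _ _ h))
    to i3 i2 _ = inj₂ refl
    to i3 i3 h = ⊥-elim (H-irrefl _ h)

    from : j ≡ next i ⊎ i ≡ next j → H (corner i) (corner j)
    from (inj₁ refl) = corner-next i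
    from (inj₂ refl) = H-sym _ _ (corner-next j)

  chordlessSquare⇒inducedCycle : InducedCycle H 4
  chordlessSquare⇒inducedCycle =
    corner , corner-injective ,
    λ i j → ⇔-sym cycAdj⇔consecutive ⇔-∘ adjacent⇔consecutive i j

record InducedPath₄ (E : Graph V) : Set where
  field
    a b c d : V
    ab : E a b
    bc : E b c
    cd : E c d
    ¬ac : ¬ E a c
    ¬ad : ¬ E a d
    ¬bd : ¬ E b d

Ball₂ : Graph V → V → V → Set
Ball₂ E u x = u ≡ x ⊎ E u x ⊎ ∃ λ z → E u z × E z x

far⇒∉ball₂ : ∀ {E : Graph V} {u v} → DistAtLeast E u v 3 → ¬ Ball₂ E u v
far⇒∉ball₂ far (inj₁ refl) with far 0 nil
... | ()
far⇒∉ball₂ far (inj₂ (inj₁ uv)) with far 1 (cons uv nil)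
... | s≤s ()
far⇒∉ball₂ far (inj₂ (inj₂ (_ , uz , zv))) with far 2 (cons uz (cons zv nil))
... | s≤s (s≤s ())

-- Leaving the ball at an edge p q, with p reached from u through b, makes u b p q induced.
ball₂-closed : ∀ {E : Graph V} {u p q} → ¬ InducedPath₄ E →
               Ball₂ E u p → E p q → ¬ ¬ Ball₂ E u q
ball₂-closed _ (inj₁ refl) pq q∉ = q∉ (inj₂ (inj₁ pq))
ball₂-closed _ (inj₂ (inj₁ up)) pq q∉ = q∉ (inj₂ (inj₂ (_ , up , pq)))
ball₂-closed {p = p} noPath (inj₂ (inj₂ (b , ub , bp))) pq q∉ = noPath record
  { ab = ub ; bc = bp ; cd = pq
  ; ¬ac = λ up → q∉ (inj₂ (inj₂ (p , up , pq)))
  ; ¬ad = λ uq → q∉ (inj₂ (inj₁ uq))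
  ; ¬bd = λ bq → q∉ (inj₂ (inj₂ (b , ub , bq)))
  }

¬¬-closed-along-walk : ∀ {E : Graph V} (P : V → Set) →
                       (∀ {p q} → P p → E p q → ¬ ¬ P q) →
                       ∀ {x w k} → Walk E x w k → ¬ ¬ P x → ¬ ¬ P w
¬¬-closed-along-walk P closed nil px = px
¬¬-closed-along-walk P closed (cons e walk) px =
  ¬¬-closed-along-walk P closed walk (λ ¬py → px (λ p → closed p e ¬py))

diameter≥3⇒¬¬inducedPath₄ : ∀ {E : Graph V} → Connected E → DiameterAtLeast E 3 →
                             ¬ ¬ InducedPath₄ E
diameter≥3⇒¬¬inducedPath₄ {E = E} connected (u , v , far) noPath =
  ¬¬-closed-along-walk (Ball₂ E u) (ball₂-closed noPath) (proj₂ (connected u v))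
    (λ u∉ → u∉ (inj₁ refl)) (far⇒∉ball₂ far)

module _ {n : ℕ} {G : Graph (Fin n)} (simple : IsSimple G) where

  open IsSimple simple renaming (sym to G-sym; irrefl to G-irrefl)

  jet-sym : ∀ s → Symmetric (Jet s G)
  jet-sym s u v (ik , j+l≤s) =
    G-sym _ _ ik , subst (_≤ s) (+-comm (toℕ (proj₂ u)) (toℕ (proj₂ v))) j+l≤s

  module _ (t : ℕ) where

    top : Fin (suc (suc t))
    top = fromℕ (suc t)

    jet-edge-bottom-top : ∀ {i k} → G i k → Jet (suc t) G (i , fzero) (k , top)
    jet-edge-bottom-top ik = ik , subst (_≤ suc t) (sym (toℕ-fromℕ (suc t))) ≤-refl

    ¬jet-edge-top-top : ∀ {i k} → ¬ Jet (suc t) G (i , top) (k , top)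
    ¬jet-edge-top-top (_ , top+top≤s) rewrite toℕ-fromℕ t =
      <-irrefl refl (m+n≤o⇒n≤o t (s≤s⁻¹ top+top≤s))

    jet-complement-square : InducedPath₄ G → ChordlessSquare (Complement (Jet (suc t) G))
    jet-complement-square path = record
      { a = a , fzero ; b = d , fzero ; c = b , top ; d = c , top
      ; ab = (λ e → a≢d (cong proj₁ e)) , (λ { (ad , _) → ¬ad ad })
      ; bc = (λ ()) , (λ { (db , _) → ¬bd (G-sym _ _ db) })
      ; cd = (λ e → b≢c (cong proj₁ e)) , ¬jet-edge-top-top
      ; da = (λ ()) , (λ { (ca , _) → ¬ac (G-sym _ _ ca) })
      ; ¬ac = λ { (_ , ¬jet) → ¬jet (jet-edge-bottom-top ab) }
      ; ¬bd = λ { (_ , ¬jet) → ¬jet (jet-edge-bottom-top (G-sym _ _ cd)) }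
      ; a≢c = λ ()
      ; b≢d = λ ()
      }
      where
      open InducedPath₄ path

      a≢d : a ≢ d
      a≢d refl = ¬ac (G-sym _ _ cd)

      b≢c : b ≢ c
      b≢c refl = G-irrefl _ bc

    jet-complement-inducedCycle₄ : InducedPath₄ G → InducedCycle (Complement (Jet (suc t) G)) 4
    jet-complement-inducedCycle₄ path =
      chordlessSquare⇒inducedCycle (complement-sym (jet-sym (suc t)))
        (complement-irrefl {E = Jet (suc t) G}) (jet-complement-square path)

theorem3 : ∀ {n : ℕ} (G : Graph (Fin n)) → IsSimple G → Connected G →
           DiameterAtLeast G 3 → ∀ (s : ℕ) → 1 ≤ s → ¬ CoChordal (Jet s G)
theorem3 G simple connected diameter≥3 (suc t) (s≤s z≤n) coChordal =
  diameter≥3⇒¬¬inducedPath₄ connected diameter≥3 λ path →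
    coChordal 4 ≤-refl (jet-complement-inducedCycle₄ simple t path)
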